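{- If a countable Rees matrix semigroup $S=\mathcal{M}^0[G;I,\Lambda;P]$ is $\aleph_0$-categorical, then $G$ and the induced bipartite graph $\Gamma(P)$ are $\aleph_0$-categorical.
   Context: A countable structure is $\aleph_0$-categorical iff its automorphism group has finitely many orbits on $n$-tuples for each $n\ge1$. A Rees matrix semigroup $\mathcal{M}^0[G;I,\Lambda;P]$: $G$ a group, $I,\Lambda$ non-empty sets, $P=(p_{\lambda,i})$ a $\Lambda\times I$ matrix over $G\cup\{0\}$ with no row or column entirely zero; underlying set $(I\times G\times\Lambda)\cup\{0\}$ with $(i,g,\lambda)(j,h,\mu)=(i,gp_{\lambda,j}h,\mu)$ if $p_{\lambda,j}\ne0$ and $0$ otherwise, $0$ a zero. The induced bipartite graph $\Gamma(P)=\langle I,\Lambda,E\rangle$ has left set $I$, right set $\Lambda$ and edges $\{i,\lambda\}$ with $p_{\lambda,i}\neq 0$, considered in the signature with unary relations for the left and right sets and a binary edge relation. -}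

module Defs where

open import Level using (0ℓ)
open import Data.Nat using (ℕ; _≤_)
open import Data.Fin using (Fin)
open import Data.List using (List)
open import Data.List.Relation.Unary.Any using (Any)
open import Data.Product using (Σ; ∃; _×_; _,_; proj₁; proj₂)
open import Data.Sum using (_⊎_; inj₁; inj₂)
open import Data.Maybe using (Maybe; just; nothing)
open import Data.Empty using (⊥)
open import Data.Unit using (⊤; tt)
open import Function.Bundles using (_⇔_)
open import Relation.Nullary using (¬_)
open import Relation.Binary.PropositionalEquality as ≡ using (_≡_)
open import Relation.Binary.Bundles using (Setoid)
open import Relation.Binary.Structures using (IsEquivalence)
open import Algebra.Bundles using (Group)

module _ (A : Setoid 0ℓ 0ℓ) where
  open Setoid A

  record IsSetoidBijection (σ : Carrier → Carrier) : Set where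
    field
      cong       : ∀ {x y} → x ≈ y → σ x ≈ σ y
      injective  : ∀ {x y} → σ x ≈ σ y → x ≈ y
      surjective : ∀ y → ∃ λ x → σ x ≈ y

  Countable : Set
  Countable = Σ (Carrier → ℕ) λ f → ∀ {x y} → f x ≡ f y → x ≈ y

  FinitelyManyOrbits : ((Carrier → Carrier) → Set) → ℕ → Set
  FinitelyManyOrbits IsAut n =
    Σ (List (Fin n → Carrier)) λ reps →
      (x : Fin n → Carrier) →
        Any (λ r → Σ (Carrier → Carrier) λ σ → IsAut σ × (∀ k → σ (r k) ≈ x k)) reps

  -- ℵ₀-categoricity of a countable structure, via the characterisation
  -- in the context (Ryll-Nardzewski): countable and the automorphism
  -- group has finitely many orbits on n-tuples for every n ≥ 1.
  AlephZeroCategorical : ((Carrier → Carrier) → Set) → Set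
  AlephZeroCategorical IsAut =
    Countable × (∀ n → 1 ≤ n → FinitelyManyOrbits IsAut n)

module _ (G : Group 0ℓ 0ℓ) where
  open Group G

  IsGroupAut : (Carrier → Carrier) → Set
  IsGroupAut σ = IsSetoidBijection setoid σ × (∀ x y → σ (x ∙ y) ≈ σ x ∙ σ y)

-- Rees matrix semigroups M⁰[G; I, Λ; P]; the entry 0 of P is `nothing`.

module Rees (G : Group 0ℓ 0ℓ) (I Λ : Set) (P : Λ → I → Maybe (Group.Carrier G)) where
  open Group G renaming (Carrier to Gc; _≈_ to _≈G_; refl to reflG; sym to symG; trans to transG)

  NoZeroRowOrColumn : Set
  NoZeroRowOrColumn =
    (∀ (l : Λ) → ∃ λ (i : I) → ¬ (P l i ≡ nothing)) ×
    (∀ (i : I) → ∃ λ (l : Λ) → ¬ (P l i ≡ nothing))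

  -- underlying set (I × G × Λ) ∪ {0}, with 0 = nothing
  S : Set
  S = Maybe (I × Gc × Λ)

  _≈S_ : S → S → Set
  nothing ≈S nothing = ⊤
  nothing ≈S just _ = ⊥
  just _ ≈S nothing = ⊥
  just (i , g , l) ≈S just (j , h , m) = i ≡ j × g ≈G h × l ≡ m

  ≈S-refl : ∀ {x} → x ≈S x
  ≈S-refl {nothing} = tt
  ≈S-refl {just _} = ≡.refl , reflG , ≡.refl

  ≈S-sym : ∀ {x y} → x ≈S y → y ≈S x
  ≈S-sym {nothing} {nothing} _ = tt
  ≈S-sym {just _} {just _} (a , b , c) = ≡.sym a , symG b , ≡.sym c

  ≈S-trans : ∀ {x y z} → x ≈S y → y ≈S z → x ≈S z
  ≈S-trans {nothing} {nothing} {nothing} _ _ = tt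
  ≈S-trans {just _} {just _} {just _} (a , b , c) (a' , b' , c') =
    ≡.trans a a' , transG b b' , ≡.trans c c'

  SSetoid : Setoid 0ℓ 0ℓ
  SSetoid = record
    { Carrier = S
    ; _≈_ = _≈S_
    ; isEquivalence = record { refl = ≈S-refl ; sym = ≈S-sym ; trans = ≈S-trans }
    }

  _·_ : S → S → S
  nothing · _ = nothing
  just _ · nothing = nothing
  just (i , g , l) · just (j , h , m) with P l j
  ... | nothing = nothing
  ... | just p = just (i , (g ∙ p) ∙ h , m)

  IsSemigroupAut : (S → S) → Set
  IsSemigroupAut σ = IsSetoidBijection SSetoid σ × (∀ x y → σ (x · y) ≈S (σ x · σ y))

  V : Set
  V = I ⊎ Λ

  VSetoid : Setoid 0ℓ 0ℓ
  VSetoid = ≡.setoid V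

  Left : V → Set
  Left (inj₁ _) = ⊤
  Left (inj₂ _) = ⊥

  Right : V → Set
  Right (inj₁ _) = ⊥
  Right (inj₂ _) = ⊤

  Edge : V → V → Set
  Edge (inj₁ i) (inj₂ l) = ¬ (P l i ≡ nothing)
  Edge (inj₂ l) (inj₁ i) = ¬ (P l i ≡ nothing)
  Edge (inj₁ _) (inj₁ _) = ⊥
  Edge (inj₂ _) (inj₂ _) = ⊥

  IsGraphAut : (V → V) → Set
  IsGraphAut σ =
    IsSetoidBijection VSetoid σ ×
    (∀ x → Left x ⇔ Left (σ x)) ×
    (∀ x → Right x ⇔ Right (σ x)) ×
    (∀ x y → Edge x y ⇔ Edge (σ x) (σ y))

-- Countability passes to G and to I ⊎ Λ along injections into S.
-- Orbits are handled by one general principle (orbits-transfer): code tuples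
-- of the target structure as tuples of S, and show that an automorphism of S
-- carrying r onto a code induces an automorphism carrying the decoding of r
-- onto the coded tuple.  Such automorphisms exist because an automorphism σ
-- of S fixes 0 and, as they are defined by divisibility, preserves Green's
-- relations ℛ (same row) and ℒ (same column) and non-vanishing of products.
-- So σ permutes rows, columns and edges of Γ(P), and it maps the group cell
-- H(i,λ) (p_{λ,i} ≠ 0) of an element onto the cell of its image, giving an
-- automorphism of G ≅ H(i,λ) ≅ H(i₀,λ₀).
module Submission where

open import Level using (0ℓ)
open import Data.Maybe using (Maybe; just; nothing)
open import Data.Product using (_×_; _,_; Σ; ∃; proj₁; proj₂)
open import Data.Product.Function.NonDependent.Propositional using (_×-⇔_)
open import Data.Sum using (_⊎_; inj₁; inj₂)
open import Data.Sum.Properties using (inj₁-injective; inj₂-injective)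
open import Data.Empty using (⊥; ⊥-elim)
open import Data.Unit using (tt)
open import Data.Nat using (ℕ; suc; _+_; _*_; _≤_; s≤s; z≤n)
open import Data.Nat.Properties using (≤-trans; m≤m+n; suc-injective; *-cancelˡ-≡; even≢odd)
open import Data.Fin using (zero; suc; _↑ˡ_; _↑ʳ_)
open import Data.Vec.Functional using (Vector; map; _++_; _∷_; tail; take; drop; zipWith)
open import Data.Vec.Functional.Properties using (lookup-++ˡ; lookup-++ʳ)
import Data.List as List
import Data.List.Relation.Unary.Any as Any
open import Data.List.Relation.Unary.Any.Properties using (map⁺)
open import Function.Base using (_∘′_)
open import Function.Bundles using (_⇔_; mk⇔; Equivalence)
open import Function.Construct.Identity using (⇔-id)
open import Function.Construct.Symmetry using (⇔-sym)
open import Function.Construct.Composition using (_⇔-∘_)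
open import Relation.Nullary using (¬_)
open import Relation.Binary.Bundles using (Setoid)
open import Relation.Binary.PropositionalEquality as ≡ using (_≡_; refl)
open import Algebra.Bundles using (Group)
open import Defs

InOrbit : (A : Setoid 0ℓ 0ℓ) → ((Setoid.Carrier A → Setoid.Carrier A) → Set) →
          ∀ {n} → Vector (Setoid.Carrier A) n → Vector (Setoid.Carrier A) n → Set
InOrbit A IsAut r x =
  Σ (Setoid.Carrier A → Setoid.Carrier A) λ σ → IsAut σ × (∀ k → Setoid._≈_ A (σ (r k)) (x k))

orbits-transfer :
  (A B : Setoid 0ℓ 0ℓ)
  {IsAutA : (Setoid.Carrier A → Setoid.Carrier A) → Set}
  {IsAutB : (Setoid.Carrier B → Setoid.Carrier B) → Set} {m n : ℕ}
  (encode : Vector (Setoid.Carrier B) n → Vector (Setoid.Carrier A) m)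
  (decode : Vector (Setoid.Carrier A) m → Vector (Setoid.Carrier B) n) →
  (∀ r x → InOrbit A IsAutA r (encode x) → InOrbit B IsAutB (decode r) x) →
  FinitelyManyOrbits A IsAutA m → FinitelyManyOrbits B IsAutB n
orbits-transfer A B encode decode induced (reps , covers) =
  List.map decode reps , λ x → map⁺ (Any.map (λ {r} → induced r x) (covers (encode x)))

countable-injection :
  (A B : Setoid 0ℓ 0ℓ) (f : Setoid.Carrier B → Setoid.Carrier A) →
  (∀ {x y} → Setoid._≈_ A (f x) (f y) → Setoid._≈_ B x y) →
  Countable A → Countable B
countable-injection A B f f-injective (c , c-injective) =
  (λ x → c (f x)) , λ e → f-injective (c-injective e)

countable-⊎ : {X Y : Set} →
  Countable (≡.setoid X) → Countable (≡.setoid Y) → Countable (≡.setoid (X ⊎ Y))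
countable-⊎ {X} {Y} (c , c-injective) (d , d-injective) = code , code-injective
  where
  code : X ⊎ Y → ℕ
  code (inj₁ x) = 2 * c x
  code (inj₂ y) = suc (2 * d y)

  code-injective : ∀ {u v} → code u ≡ code v → u ≡ v
  code-injective {inj₁ x} {inj₁ x'} e = ≡.cong inj₁ (c-injective (*-cancelˡ-≡ (c x) (c x') 2 e))
  code-injective {inj₂ y} {inj₂ y'} e = ≡.cong inj₂ (d-injective (*-cancelˡ-≡ (d y) (d y') 2 (suc-injective e)))
  code-injective {inj₁ x} {inj₂ y} e = ⊥-elim (even≢odd (c x) (d y) e)
  code-injective {inj₂ y} {inj₁ x} e = ⊥-elim (even≢odd (c x) (d y) (≡.sym e))

nonzero-entry : {A : Set} (x : Maybe A) → ¬ (x ≡ nothing) → ∃ λ a → x ≡ just a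
nonzero-entry nothing x≢0 = ⊥-elim (x≢0 refl)
nonzero-entry (just a) _ = a , refl

module ReesMatrix (G : Group 0ℓ 0ℓ) (I Λ : Set) (P : Λ → I → Maybe (Group.Carrier G))
                  (regular : Rees.NoZeroRowOrColumn G I Λ P) where
  open Group G renaming (Carrier to Gc; _≈_ to _≈G_; refl to reflG; sym to symG; trans to transG)
  open import Algebra.Properties.Group G using (\\-leftDividesˡ; //-rightDividesˡ; //-rightDividesʳ; ∙-cancelʳ)
  open import Relation.Binary.Reasoning.Setoid setoid
  open Rees G I Λ P

  ≈S-reflexive : ∀ {x y} → x ≡ y → x ≈S y
  ≈S-reflexive refl = ≈S-refl

  mul-just : ∀ {i g l j h m s} → P l j ≡ just s →
             just (i , g , l) · just (j , h , m) ≡ just (i , (g ∙ s) ∙ h , m)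
  mul-just e rewrite e = refl

  ·-cong : ∀ {x x' y y'} → x ≈S x' → y ≈S y' → (x · y) ≈S (x' · y')
  ·-cong {nothing} {nothing} _ _ = tt
  ·-cong {just _} {just _} {nothing} {nothing} _ _ = tt
  ·-cong {just (i , g , l)} {just (.i , g' , .l)} {just (j , h , m)} {just (.j , h' , .m)}
         (refl , g≈g' , refl) (refl , h≈h' , refl) with P l j
  ... | nothing = tt
  ... | just p = refl , ∙-cong (∙-congʳ g≈g') h≈h' , refl

  NonZero : S → Set
  NonZero x = ¬ (x ≈S nothing)

  NonZero-resp : ∀ {x y} → x ≈S y → NonZero x → NonZero y
  NonZero-resp x≈y x≢0 y≈0 = x≢0 (≈S-trans x≈y y≈0)

  nonzero-product : ∀ i g l j h m →
    NonZero (just (i , g , l) · just (j , h , m)) ⇔ (¬ (P l j ≡ nothing))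
  nonzero-product i g l j h m with P l j
  ... | nothing = mk⇔ (λ nz _ → nz tt) (λ nz _ → nz refl)
  ... | just _ = mk⇔ (λ _ ()) (λ _ ())

  -- Green's relations of S on non-zero elements: ℛ is "same row index",
  -- ℒ is "same column index".
  _ℛ_ : S → S → Set
  just (i , _ , _) ℛ just (j , _ , _) = i ≡ j
  _ ℛ _ = ⊥

  _ℒ_ : S → S → Set
  just (_ , _ , l) ℒ just (_ , _ , m) = l ≡ m
  _ ℒ _ = ⊥

  ℛ-respʳ : ∀ {a b b'} → b ≈S b' → a ℛ b → a ℛ b'
  ℛ-respʳ {just _} {just _} {just _} (refl , _ , _) a~b = a~b

  ℛ-respˡ : ∀ {a a' b} → a ≈S a' → a ℛ b → a' ℛ b
  ℛ-respˡ {just _} {just _} {just _} (refl , _ , _) a~b = a~b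

  ℒ-respʳ : ∀ {a b b'} → b ≈S b' → a ℒ b → a ℒ b'
  ℒ-respʳ {just _} {just _} {just _} (_ , _ , refl) a~b = a~b

  ℒ-respˡ : ∀ {a a' b} → a ≈S a' → a ℒ b → a' ℒ b
  ℒ-respˡ {just _} {just _} {just _} (_ , _ , refl) a~b = a~b

  ℋ-cell : ∀ {y i g l} → y ℛ just (i , g , l) → y ℒ just (i , g , l) →
           Σ Gc λ u → y ≈S just (i , u , l)
  ℋ-cell {just (_ , u , _)} refl refl = u , ≈S-refl

  -- ℛ is definable by right divisibility (using that no row of P is zero),
  -- and dually ℒ by left divisibility (no column of P is zero).
  ℛ-by-divisibility : ∀ a b → a ℛ b ⇔ (NonZero b × ∃ λ w → (a · w) ≈S b)
  ℛ-by-divisibility a b = mk⇔ (to a b) (λ (b≢0 , w , e) → from a w b e b≢0)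
    where
    to : ∀ a b → a ℛ b → NonZero b × ∃ λ w → (a · w) ≈S b
    to (just (i , g , l)) (just (.i , h , m)) refl with nonzero-entry (P l _) (proj₂ (proj₁ regular l))
    ... | s , eq = (λ ()) , just (_ , (g ∙ s) \\ h , m) ,
                   ≈S-trans (≈S-reflexive (mul-just eq)) (refl , \\-leftDividesˡ (g ∙ s) h , refl)
    from : ∀ a w b → (a · w) ≈S b → NonZero b → a ℛ b
    from nothing _ _ aw≈b b≢0 = ⊥-elim (b≢0 (≈S-sym aw≈b))
    from (just _) nothing _ aw≈b b≢0 = ⊥-elim (b≢0 (≈S-sym aw≈b))
    from (just (i , g , l)) (just (j , h , m)) b aw≈b b≢0 with P l j
    from (just (i , g , l)) (just (j , h , m)) b aw≈b b≢0 | nothing = ⊥-elim (b≢0 (≈S-sym aw≈b))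
    from (just (i , g , l)) (just (j , h , m)) (just _) (i≡ , _) b≢0 | just _ = i≡

  ℒ-by-divisibility : ∀ a b → a ℒ b ⇔ (NonZero b × ∃ λ w → (w · a) ≈S b)
  ℒ-by-divisibility a b = mk⇔ (to a b) (λ (b≢0 , w , e) → from w a b e b≢0)
    where
    to : ∀ a b → a ℒ b → NonZero b × ∃ λ w → (w · a) ≈S b
    to (just (i , g , l)) (just (j , h , .l)) refl with nonzero-entry (P _ i) (proj₂ (proj₂ regular i))
    ... | s , eq = (λ ()) , just (j , h // (s ∙ g) , _) ,
                   ≈S-trans (≈S-reflexive (mul-just eq))
                            (refl , transG (assoc _ s g) (//-rightDividesˡ (s ∙ g) h) , refl)
    from : ∀ w a b → (w · a) ≈S b → NonZero b → a ℒ b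
    from nothing _ _ wa≈b b≢0 = ⊥-elim (b≢0 (≈S-sym wa≈b))
    from (just _) nothing _ wa≈b b≢0 = ⊥-elim (b≢0 (≈S-sym wa≈b))
    from (just (i , g , l)) (just (j , h , m)) b wa≈b b≢0 with P l j
    from (just (i , g , l)) (just (j , h , m)) b wa≈b b≢0 | nothing = ⊥-elim (b≢0 (≈S-sym wa≈b))
    from (just (i , g , l)) (just (j , h , m)) (just _) (_ , _ , m≡) b≢0 | just _ = m≡

  module Automorphism (σ : S → S) (aut : IsSemigroupAut σ) where
    open IsSetoidBijection (proj₁ aut)
      renaming (cong to σ-cong; injective to σ-injective; surjective to σ-surjective)

    σ-hom : ∀ x y → σ (x · y) ≈S (σ x · σ y)
    σ-hom = proj₂ aut

    -- σ 0 ≈ σ (0 · z) ≈ σ 0 · σ z ≈ σ 0 · 0 ≈ 0, taking z with σ z ≈ 0.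
    σ-zero : σ nothing ≈S nothing
    σ-zero with σ-surjective nothing
    ... | z , σz≈0 = ≈S-trans (σ-hom nothing z) (≈S-trans (·-cong (≈S-refl {σ nothing}) σz≈0) (absorbs (σ nothing)))
      where
      absorbs : ∀ y → (y · nothing) ≈S nothing
      absorbs nothing = tt
      absorbs (just _) = tt

    nonzero-preserved : ∀ x → NonZero x ⇔ NonZero (σ x)
    nonzero-preserved x =
      mk⇔ (λ x≢0 σx≈0 → x≢0 (σ-injective (≈S-trans σx≈0 (≈S-sym σ-zero))))
          (λ σx≢0 x≈0 → σx≢0 (≈S-trans (σ-cong x≈0) σ-zero))

    right-divisibility-preserved : ∀ a b →
      (∃ λ w → (a · w) ≈S b) ⇔ (∃ λ w → (σ a · w) ≈S σ b)
    right-divisibility-preserved a b = mk⇔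
      (λ (w , aw≈b) → σ w , ≈S-trans (≈S-sym (σ-hom a w)) (σ-cong aw≈b))
      (λ (w' , e) → let (w , σw≈w') = σ-surjective w' in
        w , σ-injective (≈S-trans (σ-hom a w) (≈S-trans (·-cong (≈S-refl {σ a}) σw≈w') e)))

    left-divisibility-preserved : ∀ a b →
      (∃ λ w → (w · a) ≈S b) ⇔ (∃ λ w → (w · σ a) ≈S σ b)
    left-divisibility-preserved a b = mk⇔
      (λ (w , wa≈b) → σ w , ≈S-trans (≈S-sym (σ-hom w a)) (σ-cong wa≈b))
      (λ (w' , e) → let (w , σw≈w') = σ-surjective w' in
        w , σ-injective (≈S-trans (σ-hom w a) (≈S-trans (·-cong σw≈w' (≈S-refl {σ a})) e)))

    ℛ-preserved : ∀ a b → a ℛ b ⇔ σ a ℛ σ b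
    ℛ-preserved a b =
      ⇔-sym (ℛ-by-divisibility (σ a) (σ b))
        ⇔-∘ ((nonzero-preserved b ×-⇔ right-divisibility-preserved a b)
        ⇔-∘ ℛ-by-divisibility a b)

    ℒ-preserved : ∀ a b → a ℒ b ⇔ σ a ℒ σ b
    ℒ-preserved a b =
      ⇔-sym (ℒ-by-divisibility (σ a) (σ b))
        ⇔-∘ ((nonzero-preserved b ×-⇔ left-divisibility-preserved a b)
        ⇔-∘ ℒ-by-divisibility a b)

    nonzero-product-preserved : ∀ x y → NonZero (x · y) ⇔ NonZero (σ x · σ y)
    nonzero-product-preserved x y =
      mk⇔ (λ nz → NonZero-resp (σ-hom x y) (Equivalence.to (nonzero-preserved (x · y)) nz))
          (λ nz → Equivalence.from (nonzero-preserved (x · y)) (NonZero-resp (≈S-sym (σ-hom x y)) nz))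

    -- If σ maps an element of cell (i,l) into cell (i',l'), then p_{l,i} ≠ 0
    -- exactly when p_{l',i'} ≠ 0 (compare the squares of the two elements).
    sandwich-preserved : ∀ {i g l i' g' l'} → σ (just (i , g , l)) ≈S just (i' , g' , l') →
      ¬ (P l' i' ≡ nothing) → ¬ (P l i ≡ nothing)
    sandwich-preserved {i} {g} {l} {i'} {g'} {l'} hit =
      Equivalence.to (nonzero-product i g l i g l)
      ∘′ Equivalence.from (nonzero-product-preserved (just (i , g , l)) (just (i , g , l)))
      ∘′ NonZero-resp (≈S-sym (·-cong hit hit))
      ∘′ Equivalence.from (nonzero-product i' g' l' i' g' l')

  -- The group coordinate (i,u,l) ↦ u p_{l,i} of an element of a cell.  It is
  -- the inverse of the isomorphism G ≅ H(i,l) when p_{l,i} ≠ 0 (see Cell).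
  coord : S → Gc
  coord nothing = ε
  coord (just (i , u , l)) with P l i
  ... | nothing = ε
  ... | just q = u ∙ q

  coord-cong : ∀ {x y} → x ≈S y → coord x ≈G coord y
  coord-cong {nothing} {nothing} _ = reflG
  coord-cong {just (i , u , l)} {just (.i , v , .l)} (refl , u≈v , refl) with P l i
  ... | nothing = reflG
  ... | just q = ∙-congʳ u≈v

  -- A cell (i,l) whose sandwich entry p_{l,i} = q is non-zero is a subgroup
  -- of S isomorphic to G, via embed g = (i, g q⁻¹, l) with inverse coord.
  module Cell {i : I} {l : Λ} {q : Gc} (entry : P l i ≡ just q) where
    entry≢0 : ¬ (P l i ≡ nothing)
    entry≢0 e with ≡.trans (≡.sym entry) e
    ... | ()

    embed : Gc → S
    embed g = just (i , g // q , l)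

    coord-just : ∀ u → coord (just (i , u , l)) ≈G u ∙ q
    coord-just u rewrite entry = reflG

    coord-embed : ∀ g → coord (embed g) ≈G g
    coord-embed g = transG (coord-just (g // q)) (//-rightDividesˡ q g)

    embed-coord : ∀ {a u} → a ≈S just (i , u , l) → embed (coord a) ≈S a
    embed-coord {a} {u} a≈u = ≈S-trans (refl , coord-a//q≈u , refl) (≈S-sym a≈u)
      where
      coord-a//q≈u : coord a // q ≈G u
      coord-a//q≈u = transG (∙-congʳ (transG (coord-cong a≈u) (coord-just u))) (//-rightDividesʳ q u)

    embed-injective : ∀ {g h} → embed g ≈S embed h → g ≈G h
    embed-injective {g} {h} (_ , e , _) = ∙-cancelʳ (q ⁻¹) g h e

    embed-hom : ∀ g h → embed (g ∙ h) ≈S (embed g · embed h)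
    embed-hom g h = ≈S-sym (≈S-trans (≈S-reflexive (mul-just entry)) (refl , product , refl))
      where
      product : ((g // q) ∙ q) ∙ (h // q) ≈G (g ∙ h) // q
      product = begin
        ((g // q) ∙ q) ∙ (h // q) ≈⟨ ∙-congʳ (//-rightDividesˡ q g) ⟩
        g ∙ (h ∙ q ⁻¹)            ≈⟨ symG (assoc g h (q ⁻¹)) ⟩
        (g ∙ h) ∙ q ⁻¹            ∎

    coord-hom : ∀ u v →
      coord (just (i , u , l) · just (i , v , l)) ≈G coord (just (i , u , l)) ∙ coord (just (i , v , l))
    coord-hom u v = begin
      coord (just (i , u , l) · just (i , v , l))     ≡⟨ ≡.cong coord (mul-just entry) ⟩
      coord (just (i , (u ∙ q) ∙ v , l))              ≈⟨ coord-just ((u ∙ q) ∙ v) ⟩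
      ((u ∙ q) ∙ v) ∙ q                               ≈⟨ assoc (u ∙ q) v q ⟩
      (u ∙ q) ∙ (v ∙ q)                               ≈⟨ symG (∙-cong (coord-just u) (coord-just v)) ⟩
      coord (just (i , u , l)) ∙ coord (just (i , v , l)) ∎

    coord-injective : ∀ {u v} → coord (just (i , u , l)) ≈G coord (just (i , v , l)) → u ≈G v
    coord-injective {u} {v} e = ∙-cancelʳ q u v (transG (symG (coord-just u)) (transG e (coord-just v)))

  -- An automorphism σ sending an element of the group cell (i₁,l₁) into the
  -- group cell (i₀,l₀) maps the first cell onto the second (it preserves ℛ
  -- and ℒ both ways), so ψ = coord ∘ σ ∘ embed is an automorphism of G.
  module CellAutomorphism (σ : S → S) (aut : IsSemigroupAut σ)
      {i₁ i₀ : I} {l₁ l₀ : Λ} {q₁ q₀ g₁ g₀ : Gc}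
      (entry₁ : P l₁ i₁ ≡ just q₁) (entry₀ : P l₀ i₀ ≡ just q₀)
      (hit : σ (just (i₁ , g₁ , l₁)) ≈S just (i₀ , g₀ , l₀)) where
    open Automorphism σ aut
    open IsSetoidBijection (proj₁ aut)
      renaming (cong to σ-cong; injective to σ-injective; surjective to σ-surjective)
    module C₁ = Cell entry₁
    module C₀ = Cell entry₀

    image-in-cell : ∀ u → Σ Gc λ v → σ (just (i₁ , u , l₁)) ≈S just (i₀ , v , l₀)
    image-in-cell u =
      ℋ-cell (ℛ-respʳ hit (Equivalence.to (ℛ-preserved (just (i₁ , u , l₁)) (just (i₁ , g₁ , l₁))) refl))
             (ℒ-respʳ hit (Equivalence.to (ℒ-preserved (just (i₁ , u , l₁)) (just (i₁ , g₁ , l₁))) refl))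

    preimage-in-cell : ∀ a {v} → σ a ≈S just (i₀ , v , l₀) → Σ Gc λ u → a ≈S just (i₁ , u , l₁)
    preimage-in-cell a {v} σa≈ =
      ℋ-cell (Equivalence.from (ℛ-preserved a (just (i₁ , g₁ , l₁)))
               (ℛ-respʳ (≈S-sym hit) (ℛ-respˡ {just (i₀ , v , l₀)} (≈S-sym σa≈) refl)))
             (Equivalence.from (ℒ-preserved a (just (i₁ , g₁ , l₁)))
               (ℒ-respʳ (≈S-sym hit) (ℒ-respˡ {just (i₀ , v , l₀)} (≈S-sym σa≈) refl)))

    ψ : Gc → Gc
    ψ g = coord (σ (C₁.embed g))

    ψ-cong : ∀ {g h} → g ≈G h → ψ g ≈G ψ h
    ψ-cong g≈h = coord-cong (σ-cong (refl , ∙-congʳ g≈h , refl))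

    ψ-coord : ∀ a y → σ a ≈S C₀.embed y → ψ (coord a) ≈G y
    ψ-coord a y σa≈ with preimage-in-cell a σa≈
    ... | u , a≈u = begin
      ψ (coord a)         ≈⟨ coord-cong (σ-cong (C₁.embed-coord a≈u)) ⟩
      coord (σ a)         ≈⟨ coord-cong σa≈ ⟩
      coord (C₀.embed y)  ≈⟨ C₀.coord-embed y ⟩
      y                   ∎

    ψ-hom : ∀ g h → ψ (g ∙ h) ≈G ψ g ∙ ψ h
    ψ-hom g h with image-in-cell (g // q₁) | image-in-cell (h // q₁)
    ... | u , σg≈u | v , σh≈v = begin
      ψ (g ∙ h)                                           ≈⟨ coord-cong (σ-cong (C₁.embed-hom g h)) ⟩
      coord (σ (C₁.embed g · C₁.embed h))                 ≈⟨ coord-cong (σ-hom (C₁.embed g) (C₁.embed h)) ⟩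
      coord (σ (C₁.embed g) · σ (C₁.embed h))             ≈⟨ coord-cong (·-cong σg≈u σh≈v) ⟩
      coord (just (i₀ , u , l₀) · just (i₀ , v , l₀))     ≈⟨ C₀.coord-hom u v ⟩
      coord (just (i₀ , u , l₀)) ∙ coord (just (i₀ , v , l₀))
        ≈⟨ symG (∙-cong (coord-cong σg≈u) (coord-cong σh≈v)) ⟩
      ψ g ∙ ψ h                                           ∎

    ψ-injective : ∀ {g h} → ψ g ≈G ψ h → g ≈G h
    ψ-injective {g} {h} ψg≈ψh with image-in-cell (g // q₁) | image-in-cell (h // q₁)
    ... | u , σg≈u | v , σh≈v =
      C₁.embed-injective (σ-injective (≈S-trans σg≈u (≈S-trans (refl , u≈v , refl) (≈S-sym σh≈v))))
      where
      u≈v : u ≈G v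
      u≈v = C₀.coord-injective (transG (coord-cong (≈S-sym σg≈u)) (transG ψg≈ψh (coord-cong σh≈v)))

    ψ-aut : IsGroupAut G ψ
    ψ-aut =
      record { cong = ψ-cong ; injective = ψ-injective
             ; surjective = λ y → let (a , σa≈) = σ-surjective (C₀.embed y) in coord a , ψ-coord a y σa≈ } ,
      ψ-hom

  -- n-tuples of G are coded inside a fixed group cell (i₀,l₀), preceded by an
  -- element of that cell which fixes the cell an automorphism starts from.
  module GroupCoding {i₀ : I} {l₀ : Λ} {q₀ : Gc} (entry₀ : P l₀ i₀ ≡ just q₀) where
    open Cell entry₀ using (embed; entry≢0)

    encode : ∀ {n} → Vector Gc n → Vector S (suc n)
    encode x = embed ε ∷ map embed x

    decode : ∀ {n} → Vector S (suc n) → Vector Gc n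
    decode r = map coord (tail r)

    induced : ∀ {n} (r : Vector S (suc n)) (x : Vector Gc n) →
      InOrbit SSetoid IsSemigroupAut r (encode x) → InOrbit setoid (IsGroupAut G) (decode r) x
    induced r x (σ , aut , σr≈) with r zero | σr≈ zero
    ... | nothing | σ0≈code = ⊥-elim (≈S-trans (≈S-sym (Automorphism.σ-zero σ aut)) σ0≈code)
    ... | just (i₁ , g₁ , l₁) | hit
          with nonzero-entry (P l₁ i₁) (Automorphism.sandwich-preserved σ aut hit entry≢0)
    ...   | q₁ , entry₁ = ψ , ψ-aut , λ k → ψ-coord (r (suc k)) (x k) (σr≈ (suc k))
      where open CellAutomorphism σ aut entry₁ entry₀ hit

  group-categorical : ∀ {i₀ l₀ q₀} → P l₀ i₀ ≡ just q₀ →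
    Countable SSetoid → (∀ m → 1 ≤ m → FinitelyManyOrbits SSetoid IsSemigroupAut m) →
    AlephZeroCategorical setoid (IsGroupAut G)
  group-categorical entry₀ countable orbits =
    countable-injection SSetoid setoid embed embed-injective countable ,
    λ n _ → orbits-transfer SSetoid setoid encode decode induced (orbits (suc n) (s≤s z≤n))
    where
    open Cell entry₀ using (embed; embed-injective)
    open GroupCoding entry₀

  -- A vertex of Γ(P) is a row or a column of S; it is coded by a
  -- representative of that row/column and a marker (zero for a row).
  module GraphCoding (i₀ : I) (l₀ : Λ) where
    inRow : I → S
    inRow i = just (i , ε , l₀)

    inColumn : Λ → S
    inColumn l = just (i₀ , ε , l)

    -- row and column index of an element (arbitrary on 0)
    row : S → I
    row nothing = i₀
    row (just (i , _ , _)) = i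

    column : S → Λ
    column nothing = l₀
    column (just (_ , _ , l)) = l

    ℛ⇒row≡ : ∀ {a b} → a ℛ b → row a ≡ row b
    ℛ⇒row≡ {just _} {just _} i≡j = i≡j

    row≡⇒ℛ : ∀ {a b} → NonZero a → NonZero b → row a ≡ row b → a ℛ b
    row≡⇒ℛ {nothing} a≢0 _ _ = ⊥-elim (a≢0 tt)
    row≡⇒ℛ {just _} {nothing} _ b≢0 _ = ⊥-elim (b≢0 tt)
    row≡⇒ℛ {just _} {just _} _ _ i≡j = i≡j

    ℒ⇒column≡ : ∀ {a b} → a ℒ b → column a ≡ column b
    ℒ⇒column≡ {just _} {just _} l≡m = l≡m

    column≡⇒ℒ : ∀ {a b} → NonZero a → NonZero b → column a ≡ column b → a ℒ b
    column≡⇒ℒ {nothing} a≢0 _ _ = ⊥-elim (a≢0 tt)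
    column≡⇒ℒ {just _} {nothing} _ b≢0 _ = ⊥-elim (b≢0 tt)
    column≡⇒ℒ {just _} {just _} _ _ l≡m = l≡m

    nonzero-product-rc : ∀ a b → NonZero a → NonZero b →
      NonZero (a · b) ⇔ (¬ (P (column a) (row b) ≡ nothing))
    nonzero-product-rc nothing _ a≢0 _ = ⊥-elim (a≢0 tt)
    nonzero-product-rc (just _) nothing _ b≢0 = ⊥-elim (b≢0 tt)
    nonzero-product-rc (just (i , g , l)) (just (j , h , m)) _ _ = nonzero-product i g l j h m

    point : V → S
    point (inj₁ i) = inRow i
    point (inj₂ l) = inColumn l

    marker : V → S
    marker (inj₁ _) = nothing
    marker (inj₂ _) = inRow i₀

    vertexOf : S → S → V
    vertexOf a nothing = inj₁ (row a)
    vertexOf a (just _) = inj₂ (column a)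

    encode : ∀ {n} → Vector V n → Vector S (n + n)
    encode x = map point x ++ map marker x

    decode : ∀ {n} → Vector S (n + n) → Vector V n
    decode {n} r = zipWith vertexOf (take n r) (drop n r)

    module GraphAutomorphism (σ : S → S) (aut : IsSemigroupAut σ) where
      open Automorphism σ aut
      open IsSetoidBijection (proj₁ aut) using () renaming (surjective to σ-surjective)

      τ : V → V
      τ (inj₁ i) = inj₁ (row (σ (inRow i)))
      τ (inj₂ l) = inj₂ (column (σ (inColumn l)))

      σ-nonzero : ∀ {t} → NonZero (σ (just t))
      σ-nonzero {t} = Equivalence.to (nonzero-preserved (just t)) (λ ())

      σ-zero-not-just : ∀ {t} → σ nothing ≈S just t → ⊥
      σ-zero-not-just σ0≈t = ≈S-trans (≈S-sym σ-zero) σ0≈t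

      row-image : ∀ a {i g l} → σ a ≈S just (i , g , l) → row (σ (inRow (row a))) ≡ i
      row-image nothing σ0≈ = ⊥-elim (σ-zero-not-just σ0≈)
      row-image (just (i , g , l)) σa≈ =
        ℛ⇒row≡ (ℛ-respʳ σa≈ (Equivalence.to (ℛ-preserved (inRow i) (just (i , g , l))) refl))

      column-image : ∀ a {i g l} → σ a ≈S just (i , g , l) → column (σ (inColumn (column a))) ≡ l
      column-image nothing σ0≈ = ⊥-elim (σ-zero-not-just σ0≈)
      column-image (just (i , g , l)) σa≈ =
        ℒ⇒column≡ (ℒ-respʳ σa≈ (Equivalence.to (ℒ-preserved (inColumn l) (just (i , g , l))) refl))

      τ-injective : ∀ {v w} → τ v ≡ τ w → v ≡ w
      τ-injective {inj₁ i} {inj₁ j} e = ≡.cong inj₁ (Equivalence.from (ℛ-preserved (inRow i) (inRow j))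
        (row≡⇒ℛ σ-nonzero σ-nonzero (inj₁-injective e)))
      τ-injective {inj₂ l} {inj₂ m} e = ≡.cong inj₂ (Equivalence.from (ℒ-preserved (inColumn l) (inColumn m))
        (column≡⇒ℒ σ-nonzero σ-nonzero (inj₂-injective e)))
      τ-injective {inj₁ _} {inj₂ _} ()
      τ-injective {inj₂ _} {inj₁ _} ()

      τ-surjective : ∀ w → ∃ λ v → τ v ≡ w
      τ-surjective (inj₁ i) =
        let (a , σa≈) = σ-surjective (inRow i) in inj₁ (row a) , ≡.cong inj₁ (row-image a σa≈)
      τ-surjective (inj₂ l) =
        let (a , σa≈) = σ-surjective (inColumn l) in inj₂ (column a) , ≡.cong inj₂ (column-image a σa≈)

      edge-preserved : ∀ i l →
        (¬ (P l i ≡ nothing)) ⇔ (¬ (P (column (σ (inColumn l))) (row (σ (inRow i))) ≡ nothing))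
      edge-preserved i l =
        nonzero-product-rc (σ (inColumn l)) (σ (inRow i)) σ-nonzero σ-nonzero
          ⇔-∘ (nonzero-product-preserved (inColumn l) (inRow i)
          ⇔-∘ ⇔-sym (nonzero-product i₀ ε l i ε l₀))

      τ-edge : ∀ v w → Edge v w ⇔ Edge (τ v) (τ w)
      τ-edge (inj₁ i) (inj₂ l) = edge-preserved i l
      τ-edge (inj₂ l) (inj₁ i) = edge-preserved i l
      τ-edge (inj₁ _) (inj₁ _) = ⇔-id _
      τ-edge (inj₂ _) (inj₂ _) = ⇔-id _

      τ-left : ∀ v → Left v ⇔ Left (τ v)
      τ-left (inj₁ _) = ⇔-id _
      τ-left (inj₂ _) = ⇔-id _

      τ-right : ∀ v → Right v ⇔ Right (τ v)
      τ-right (inj₁ _) = ⇔-id _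
      τ-right (inj₂ _) = ⇔-id _

      τ-aut : IsGraphAut τ
      τ-aut = record { cong = ≡.cong τ ; injective = τ-injective ; surjective = τ-surjective } ,
              τ-left , τ-right , τ-edge

      τ-vertexOf : ∀ a b v → σ a ≈S point v → σ b ≈S marker v → τ (vertexOf a b) ≡ v
      τ-vertexOf a nothing (inj₁ i) σa≈ _ = ≡.cong inj₁ (row-image a σa≈)
      τ-vertexOf a nothing (inj₂ l) _ σ0≈ = ⊥-elim (σ-zero-not-just σ0≈)
      τ-vertexOf a (just _) (inj₁ i) _ σb≈0 = ⊥-elim (σ-nonzero σb≈0)
      τ-vertexOf a (just _) (inj₂ l) σa≈ _ = ≡.cong inj₂ (column-image a σa≈)

    induced : ∀ {n} (r : Vector S (n + n)) (x : Vector V n) →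
      InOrbit SSetoid IsSemigroupAut r (encode x) → InOrbit VSetoid IsGraphAut (decode r) x
    induced {n} r x (σ , aut , σr≈) = τ , τ-aut , λ k →
      τ-vertexOf (r (k ↑ˡ n)) (r (n ↑ʳ k)) (x k)
        (≈S-trans (σr≈ (k ↑ˡ n)) (≈S-reflexive (lookup-++ˡ (map point x) (map marker x) k)))
        (≈S-trans (σr≈ (n ↑ʳ k)) (≈S-reflexive (lookup-++ʳ (map point x) (map marker x) k)))
      where open GraphAutomorphism σ aut

  graph-categorical : I → Λ →
    Countable SSetoid → (∀ m → 1 ≤ m → FinitelyManyOrbits SSetoid IsSemigroupAut m) →
    AlephZeroCategorical VSetoid IsGraphAut
  graph-categorical i₀ l₀ countable orbits =
    countable-⊎ (countable-injection SSetoid (≡.setoid I) inRow proj₁ countable)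
                (countable-injection SSetoid (≡.setoid Λ) inColumn (λ e → proj₂ (proj₂ e)) countable) ,
    λ n n≥1 → orbits-transfer SSetoid VSetoid encode decode induced (orbits (n + n) (≤-trans n≥1 (m≤m+n n n)))
    where open GraphCoding i₀ l₀

proposition5p11 : (G : Group 0ℓ 0ℓ) (I Λ : Set) (P : Λ → I → Maybe (Group.Carrier G)) →
    I → Λ → Rees.NoZeroRowOrColumn G I Λ P →
    Countable (Rees.SSetoid G I Λ P) →
    AlephZeroCategorical (Rees.SSetoid G I Λ P) (Rees.IsSemigroupAut G I Λ P) →
    AlephZeroCategorical (Group.setoid G) (IsGroupAut G) ×
    AlephZeroCategorical (Rees.VSetoid G I Λ P) (Rees.IsGraphAut G I Λ P)
proposition5p11 G I Λ P i₀ l₀ regular countable (_ , orbits)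
  with nonzero-entry (P l₀ (proj₁ (proj₁ regular l₀))) (proj₂ (proj₁ regular l₀))
... | q₀ , entry₀ =
  group-categorical entry₀ countable orbits , graph-categorical i₀ l₀ countable orbits
  where open ReesMatrix G I Λ P regular
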